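{- Let $G$ be a group with finite generating set $S$. If $\mathrm{Geo}(G,S)$ is a regular language, then the geodesic skeleton subshift $X^g_{G,S}$ is sofic.
   Context: A word over $S\cup S^{ -1}$ is a geodesic if no word representing the same element of $G$ is shorter; $\mathrm{Geo}(G,S)$ is the set of geodesic words. $\mathrm{WP}(G,S)$ is the set of words evaluating to $1_G$, and $X_{G,S}=\{x\in(S\cup S^{ -1})^{\mathbb{Z}}: \text{no nonempty finite factor of } x \text{ lies in } \mathrm{WP}(G,S)\}$. The geodesic skeleton subshift is $X^g_{G,S}=\{x\in X_{G,S}: \text{every finite factor of } x \text{ is a geodesic}\}$. A subshift is sofic if it is the set of configurations avoiding some regular language of forbidden words. -}

module Defs where

open import Level using (Level; _⊔_)
open import Data.Nat using (ℕ; zero; suc; _≤_; _≥_)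
open import Data.Fin using (Fin)
open import Data.Bool using (Bool; true; false)
open import Data.Product using (_×_; _,_; Σ; ∃)
open import Data.List using (List; []; _∷_; length)
open import Data.Integer using (ℤ; +_) renaming (_+_ to _+ℤ_)
open import Relation.Binary.PropositionalEquality using (_≡_)
open import Relation.Nullary using (¬_)
open import Function.Bundles using (_⇔_)
open import Algebra.Bundles using (Group)

-- Formal alphabet S ∪ S⁻¹ for a generating set indexed by Fin k:
-- (i , true) is the letter s_i, (i , false) is the letter s_i⁻¹.
Letter : ℕ → Set
Letter k = Fin k × Bool

Word : ℕ → Set
Word k = List (Letter k)

record DFA (A : Set) : Set where
  field
    nStates : ℕ
    start   : Fin nStates
    δ       : Fin nStates → A → Fin nStates
    final   : Fin nStates → Bool

run : ∀ {A} (D : DFA A) → Fin (DFA.nStates D) → List A → Fin (DFA.nStates D)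
run D q []      = q
run D q (a ∷ w) = run D (DFA.δ D q a) w

accepts : ∀ {A} → DFA A → List A → Bool
accepts D w = DFA.final D (run D (DFA.start D) w)

IsRegular : ∀ {A : Set} {ℓ} → (List A → Set ℓ) → Set ℓ
IsRegular {A} L = Σ (DFA A) λ D → ∀ w → L w ⇔ (accepts D w ≡ true)

Config : Set → Set
Config A = ℤ → A

factor : ∀ {A} → Config A → ℤ → ℕ → List A
factor x i zero    = []
factor x i (suc n) = x i ∷ factor x (i +ℤ + 1) n

IsSofic : ∀ {A : Set} {ℓ} → (Config A → Set ℓ) → Set ℓ
IsSofic {A} X = Σ (DFA A) λ D →
  ∀ x → X x ⇔ (∀ i n → accepts D (factor x i n) ≡ false)

module WithGroup {c ℓ} (G : Group c ℓ) {k : ℕ} (S : Fin k → Group.Carrier G) where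
  open Group G

  letterVal : Letter k → Carrier
  letterVal (i , true)  = S i
  letterVal (i , false) = S i ⁻¹

  eval : Word k → Carrier
  eval []      = ε
  eval (a ∷ w) = letterVal a ∙ eval w

  IsFiniteGeneratingSet : Set (c ⊔ ℓ)
  IsFiniteGeneratingSet =
    (∀ i j → S i ≈ S j → i ≡ j) × (∀ g → ∃ λ (w : Word k) → eval w ≈ g)

  WP : Word k → Set ℓ
  WP w = eval w ≈ ε

  Geo : Word k → Set ℓ
  Geo w = ∀ (v : Word k) → eval v ≈ eval w → length w ≤ length v

  InX : Config (Letter k) → Set ℓ
  InX x = ∀ (i : ℤ) (n : ℕ) → n ≥ 1 → ¬ WP (factor x i n)

  InXg : Config (Letter k) → Set ℓ
  InXg x = InX x × (∀ (i : ℤ) (n : ℕ) → Geo (factor x i n))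

{-# OPTIONS --safe #-}
module Submission where

open import Defs
open import Data.Nat using (ℕ; zero; suc)
open import Data.Fin using (Fin)
open import Data.Bool using (true; false; not)
open import Data.Bool.Properties using (not-injective)
open import Data.Product using (_,_; proj₂)
open import Data.List using (List; []; _∷_)
open import Relation.Binary.PropositionalEquality using (_≡_; refl; cong; sym; trans)
open import Function.Bundles using (_⇔_; mk⇔; Equivalence)
open import Function.Properties.Equivalence using () renaming (trans to ⇔-trans)
open import Algebra.Bundles using (Group)

open Equivalence using (to; from)

-- Requiring every factor to be geodesic means avoiding the complement of Geo, which is
-- regular because a DFA can be complemented. The defining condition of X then comes
-- for free: a nonempty word evaluating to 1 is not geodesic, the empty word being shorter.

complement : ∀ {A} → DFA A → DFA A
complement D = record D { final = λ q → not (DFA.final D q) }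

run-complement : ∀ {A} (D : DFA A) q (w : List A) → run (complement D) q w ≡ run D q w
run-complement D q []      = refl
run-complement D q (a ∷ w) = run-complement D (DFA.δ D q a) w

accepts-complement : ∀ {A} (D : DFA A) (w : List A) →
                     accepts (complement D) w ≡ not (accepts D w)
accepts-complement D w = cong (λ q → not (DFA.final D q)) (run-complement D (DFA.start D) w)

accepts⇔rejected-by-complement : ∀ {A} (D : DFA A) (w : List A) →
                                 (accepts D w ≡ true) ⇔ (accepts (complement D) w ≡ false)
accepts⇔rejected-by-complement D w = mk⇔
  (λ acc → trans (accepts-complement D w) (cong not acc))
  (λ rej → not-injective (trans (sym (accepts-complement D w)) rej))

allFactorsIn-sofic : ∀ {A : Set} {ℓ} {L : List A → Set ℓ} → IsRegular L →
                     IsSofic (λ x → ∀ i n → L (factor x i n))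
allFactorsIn-sofic {L = L} (D , D-recognises-L) = complement D , λ x →
  mk⇔ (λ inL i n → to (L⇔rejected _) (inL i n))
      (λ avoids i n → from (L⇔rejected _) (avoids i n))
  where
  L⇔rejected : ∀ w → L w ⇔ (accepts (complement D) w ≡ false)
  L⇔rejected w = ⇔-trans (D-recognises-L w) (accepts⇔rejected-by-complement D w)

module _ {c ℓ} (G : Group c ℓ) {k : ℕ} (S : Fin k → Group.Carrier G) where
  open Group G using () renaming (sym to ≈-sym)
  open WithGroup G S

  geodesic-WP⇒empty : ∀ {w} → Geo w → WP w → w ≡ []
  geodesic-WP⇒empty {[]}    _   _  = refl
  geodesic-WP⇒empty {_ ∷ _} geo wp with geo [] (≈-sym wp)
  ... | ()

  geodesicFactors⇒InX : ∀ x → (∀ i n → Geo (factor x i n)) → InX x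
  geodesicFactors⇒InX x geo i zero    ()
  geodesicFactors⇒InX x geo i (suc n) _ wp
    with geodesic-WP⇒empty {factor x i (suc n)} (geo i (suc n)) wp
  ... | ()

  InXg⇔geodesicFactors : ∀ x → InXg x ⇔ (∀ i n → Geo (factor x i n))
  InXg⇔geodesicFactors x = mk⇔ proj₂ (λ geo → geodesicFactors⇒InX x geo , geo)

proposition6 : ∀ {c ℓ} (G : Group c ℓ) (k : ℕ) (S : Fin k → Group.Carrier G) →
    WithGroup.IsFiniteGeneratingSet G S →
    IsRegular (WithGroup.Geo G S) →
    IsSofic (WithGroup.InXg G S)
proposition6 G k S _ geo-regular with allFactorsIn-sofic geo-regular
... | D , avoids-D⇔geodesicFactors =
  D , λ x → ⇔-trans (InXg⇔geodesicFactors G S x) (avoids-D⇔geodesicFactors x)
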